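{- Let $p\ge3$ be an integer, $u$ an integer coprime to $p$, and $r_1$ the integer with $0<r_1<p$ and $ur_1\equiv1\pmod p$. Put $r_0=p$ and for $1\le i\le t$ define integers $Z_i$, $r_{i+1}$ by $r_{i-1}=Z_ir_i+r_{i+1}$, $0\le r_{i+1}<r_i$, where $t$ is the index with $r_t=1$. Let $k\ge1$ be an integer with $2k\le t$, let $0\le z\le Z_{2k}-1$, and put $b=r_{2k-1}-zr_{2k}$. Then $$\langle ub\rangle_p<\min_{0<n<b}\langle un\rangle_p,$$ and consequently $r_{2k-1}-zr_{2k}\in D_\Delta$, where $D_\Delta=\{b'-a : (a,b')\in D\}$ and $D$ is the set of integer pairs $(a,b')$, $a<b'$, with $\max(\langle ua\rangle_p,\langle ub'\rangle_p)<\min_{a<n<b'}\langle un\rangle_p$ (vacuous when $b'=a+1$).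
   Context: $\langle x\rangle_p$ denotes the least nonnegative residue of the integer $x$ modulo $p$. -}

module Defs where

open import Data.Nat using (ℕ; NonZero; _⊔_) renaming (_<_ to _<ℕ_)
open import Data.Integer using (ℤ; +_; _*_; _-_; _<_; _%ℕ_)
open import Data.Product using (_×_; ∃-syntax)
open import Relation.Binary.PropositionalEquality using (_≡_)

⟨_⟩ : ℤ → (p : ℕ) .{{_ : NonZero p}} → ℕ
⟨ x ⟩ p = x %ℕ p

InD : (u : ℤ) (p : ℕ) .{{_ : NonZero p}} → ℤ → ℤ → Set
InD u p a b' =
  (a < b') ×
  (∀ (n : ℤ) → a < n → n < b' → (⟨ u * a ⟩ p ⊔ ⟨ u * b' ⟩ p) <ℕ ⟨ u * n ⟩ p)

InDΔ : (u : ℤ) (p : ℕ) .{{_ : NonZero p}} → ℤ → Set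
InDΔ u p d = ∃[ a ] ∃[ b' ] (InD u p a b' × (b' - a ≡ d))

-- Let A = r (2k − 1) and B = r (2k). Along the Euclidean algorithm one keeps C ≥ 0 and D > 0
-- with u A ≡ C, u B ≡ − D (mod p) and A D + B C = p, so that (A , C) and (B , − D) span the
-- lattice {(n , v) | u n ≡ v (mod p)}; a division step r (i − 1) = Z i r i + r (i + 1) yields
-- such data for the next pair of remainders, with u replaced by − u. Now b = A − z B has
-- ⟨u b⟩ ≤ z D + C. For 0 < n < b write (n , ⟨u n⟩) = α (A , C) − β (B , − D): by Cramer's rule
-- α p = n D + ⟨u n⟩ B > 0, and β ≤ z would give n ≥ A − z B = b, so β > z and
-- ⟨u n⟩ = α C + β D > z D + C. The pair (0 , b) then witnesses b ∈ D_Δ.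

module Submission where

open import Data.Integer.Base using (ℤ; -_)
import Data.Nat.Base as ℕ
import Data.Nat.Properties as ℕ
open import Data.Product.Base using (∃₂; _×_; _,_; proj₁; proj₂)
open import Relation.Binary.PropositionalEquality
open import Defs

module _ where

  open import Data.Integer.Base
    using (+_; _+_; _-_; _*_; _≤_; _<_; 0ℤ; 1ℤ; NonZero; +≤+; +<+; _/ℕ_)
    renaming (suc to sucℤ)
  open import Data.Integer.Properties
  open import Data.Integer.DivMod using (a≡a%ℕn+[a/ℕn]*n; n%ℕd<d)
  open import Data.Integer.Divisibility.Signed
  open import Data.Integer.Tactic.RingSolver using (solve; solve-∀)
  open import Data.List.Base using ([]; _∷_)
  open import Relation.Nullary.Decidable using (yes; no)
  open import Relation.Nullary.Negation using (contradiction)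

  pos-*-+ : ∀ k b a → + (k ℕ.* b ℕ.+ a) ≡ + k * + b + + a
  pos-*-+ k b a = trans (pos-+ (k ℕ.* b) a) (cong (_+ + a) (pos-* k b))

  n≤i*n : ∀ {i} n → 0ℤ < i → + n ≤ i * + n
  n≤i*n {i} n 0<i = begin
    + n      ≡⟨ *-identityˡ (+ n) ⟨
    1ℤ * + n ≤⟨ *-monoʳ-≤-nonNeg (+ n) (i<j⇒suc[i]≤j 0<i) ⟩
    i * + n  ∎
    where open ≤-Reasoning

  i*n<suc[i]*n : ∀ i {n} → 0 ℕ.< n → i * + n < sucℤ i * + n
  i*n<suc[i]*n i {n} 0<n = begin-strict
    i * + n        ≡⟨ +-identityˡ (i * + n) ⟨
    0ℤ + i * + n   <⟨ +-monoˡ-< (i * + n) (+<+ 0<n) ⟩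
    + n + i * + n  ≡⟨ suc-* i (+ n) ⟨
    sucℤ i * + n   ∎
    where open ≤-Reasoning

  -- The equation comes last so that the ring solver, when used to prove it, sees both sides.
  ∣-resp : ∀ {k i j} → k ∣ i → i ≡ j → k ∣ j
  ∣-resp k∣i i≡j = subst (_ ∣_) i≡j k∣i

  module CongruenceLattice (P : ℤ) where

    record Basis (w A B C D : ℤ) : Set where
      field
        det   : A * D + B * C ≡ P
        wA≡C  : P ∣ w * A - C
        wB≡-D : P ∣ w * B + D

    inverse-basis : ∀ {w B} → P ∣ w * B - 1ℤ → Basis (- w) P B 0ℤ 1ℤ
    inverse-basis {w} {B} wB≡1 = record
      { det   = solve (P ∷ B ∷ [])
      ; wA≡C  = ∣-resp (∣n⇒∣m*n (- w) ∣-refl) (solve (w ∷ P ∷ []))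
      ; wB≡-D = ∣-resp (∣m⇒∣-m wB≡1) (solve (w ∷ B ∷ []))
      }

    basis-step : ∀ {w A B C D k A′} → Basis w A B C D → A ≡ k * B + A′ →
                 Basis (- w) B A′ D (k * D + C)
    basis-step {w} {_} {B} {C} {D} {k} {A′} basis refl = record
      { det   = begin
          B * (k * D + C) + A′ * D ≡⟨ solve (B ∷ C ∷ D ∷ k ∷ A′ ∷ []) ⟩
          (k * B + A′) * D + B * C ≡⟨ det ⟩
          P                        ∎
      ; wA≡C  = ∣-resp (∣m⇒∣-m wB≡-D) (solve (w ∷ B ∷ D ∷ []))
      ; wB≡-D = ∣-resp (∣m∣n⇒∣m-n (∣n⇒∣m*n k wB≡-D) wA≡C)
                  (solve (w ∷ B ∷ C ∷ D ∷ k ∷ A′ ∷ []))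
      }
      where
        open Basis basis
        open ≡-Reasoning

    basis-truncation : ∀ {w A B C D z b} → Basis w A B C D → A ≡ z * B + b →
                       P ∣ w * b - (z * D + C)
    basis-truncation {w} {_} {B} {C} {D} {z} {b} basis refl =
      ∣-resp (∣m∣n⇒∣m-n wA≡C (∣n⇒∣m*n z wB≡-D))
        (solve (w ∷ B ∷ C ∷ D ∷ z ∷ b ∷ []))
      where open Basis basis

    cramer : ∀ {A B C D n v α β} .{{_ : NonZero P}} → A * D + B * C ≡ P →
             n * D + v * B ≡ α * P → v * A - n * C ≡ β * P →
             α * A ≡ β * B + n × v ≡ α * C + β * D
    cramer {A} {B} {C} {D} {n} {v} {α} {β} det nD+vB≡αP vA-nC≡βP =
      *-cancelˡ-≡ P _ _ P[αA]≡P[βB+n] , *-cancelˡ-≡ P _ _ Pv≡P[αC+βD]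
      where
        open ≡-Reasoning
        P[αA]≡P[βB+n] : P * (α * A) ≡ P * (β * B + n)
        P[αA]≡P[βB+n] = begin
          P * (α * A)                               ≡⟨ solve (P ∷ α ∷ A ∷ []) ⟩
          (α * P) * A                               ≡⟨ cong (_* A) nD+vB≡αP ⟨
          (n * D + v * B) * A                       ≡⟨ solve (A ∷ B ∷ C ∷ D ∷ n ∷ v ∷ []) ⟩
          (v * A - n * C) * B + n * (A * D + B * C) ≡⟨ cong₂ (λ x y → x * B + n * y) vA-nC≡βP det ⟩
          (β * P) * B + n * P                       ≡⟨ solve (P ∷ β ∷ B ∷ n ∷ []) ⟩
          P * (β * B + n)                           ∎
        Pv≡P[αC+βD] : P * v ≡ P * (α * C + β * D)
        Pv≡P[αC+βD] = begin
          P * v                                     ≡⟨ cong (_* v) det ⟨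
          (A * D + B * C) * v                       ≡⟨ solve (A ∷ B ∷ C ∷ D ∷ n ∷ v ∷ []) ⟩
          (n * D + v * B) * C + (v * A - n * C) * D ≡⟨ cong₂ (λ x y → x * C + y * D) nD+vB≡αP vA-nC≡βP ⟩
          (α * P) * C + (β * P) * D                 ≡⟨ solve (P ∷ α ∷ β ∷ C ∷ D ∷ []) ⟩
          P * (α * C + β * D)                       ∎

    basis-coordinates : ∀ {w A B C D n v} .{{_ : NonZero P}} →
                        Basis w A B C D → P ∣ w * n - v →
                        ∃₂ λ α β → n * D + v * B ≡ α * P × α * A ≡ β * B + n × v ≡ α * C + β * D
    basis-coordinates {w} {A} {B} {C} {D} {n} {v} basis wn≡v =
      let divides α nD+vB≡αP = P∣nD+vB
          divides β vA-nC≡βP = P∣vA-nC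
      in α , β , nD+vB≡αP ,
         cramer {A} {B} {C} {D} {n} {v} {α} {β} det nD+vB≡αP vA-nC≡βP
      where
        open Basis basis
        P∣nD+vB : P ∣ n * D + v * B
        P∣nD+vB = ∣-resp (∣m∣n⇒∣m-n (∣n⇒∣m*n n wB≡-D) (∣n⇒∣m*n B wn≡v))
                    (solve (w ∷ B ∷ D ∷ n ∷ v ∷ []))
        P∣vA-nC : P ∣ v * A - n * C
        P∣vA-nC = ∣-resp (∣m∣n⇒∣m-n (∣n⇒∣m*n n wA≡C) (∣n⇒∣m*n A wn≡v))
                    (solve (w ∷ A ∷ C ∷ n ∷ v ∷ []))

  lattice-point-above : ∀ {A B C D : ℕ.ℕ} {n v z α β : ℤ} → 0 ℕ.< D → 0ℤ < α →
                        z * + B + n < + A → α * + A ≡ β * + B + n → v ≡ α * + C + β * + D →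
                        z * + D + + C < v
  lattice-point-above {A} {B} {C} {D} {n} {v} {z} {α} {β} 0<D 0<α zB+n<A αA≡βB+n v≡αC+βD
    with β ≤? z
  ... | yes β≤z = contradiction zB+n<A (≤⇒≯ (begin
    + A         ≤⟨ n≤i*n A 0<α ⟩
    α * + A     ≡⟨ αA≡βB+n ⟩
    β * + B + n ≤⟨ +-monoˡ-≤ n (*-monoʳ-≤-nonNeg (+ B) β≤z) ⟩
    z * + B + n ∎))
    where open ≤-Reasoning
  ... | no β≰z = begin-strict
    z * + D + + C      <⟨ +-monoˡ-< (+ C) (i*n<suc[i]*n z 0<D) ⟩
    sucℤ z * + D + + C ≤⟨ +-mono-≤ (*-monoʳ-≤-nonNeg (+ D) (i<j⇒suc[i]≤j (≰⇒> β≰z))) (n≤i*n C 0<α) ⟩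
    β * + D + α * + C  ≡⟨ +-comm (β * + D) (α * + C) ⟩
    α * + C + β * + D  ≡⟨ v≡αC+βD ⟨
    v                  ∎
    where open ≤-Reasoning

  PrefixMinimum : (w : ℤ) (p : ℕ.ℕ) .{{_ : ℕ.NonZero p}} → ℕ.ℕ → Set
  PrefixMinimum w p b = ∀ n → 0 ℕ.< n → n ℕ.< b → ⟨ w * + b ⟩ p ℕ.< ⟨ w * + n ⟩ p

  module _ {p : ℕ.ℕ} .{{_ : ℕ.NonZero p}} where

    open CongruenceLattice (+ p)

    residue-congruence : ∀ x → + p ∣ x - + ⟨ x ⟩ p
    residue-congruence x = divides (x /ℕ p) (begin
      x - + ⟨ x ⟩ p                          ≡⟨ cong (_- + ⟨ x ⟩ p) (a≡a%ℕn+[a/ℕn]*n x p) ⟩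
      + ⟨ x ⟩ p + (x /ℕ p) * + p - + ⟨ x ⟩ p ≡⟨ [i+j]-i≡j (+ ⟨ x ⟩ p) ((x /ℕ p) * + p) ⟩
      (x /ℕ p) * + p                         ∎)
      where
        open ≡-Reasoning
        [i+j]-i≡j : ∀ i j → i + j - i ≡ j
        [i+j]-i≡j = solve-∀

    p∣m-v∧m<p⇒m≤v : ∀ {m v} → + p ∣ + m - + v → m ℕ.< p → m ℕ.≤ v
    p∣m-v∧m<p⇒m≤v {m} {v} (divides c m-v≡cp) m<p = drop‿+≤+ (i-j≤0⇒i≤j (begin
      + m - + v ≡⟨ m-v≡cp ⟩
      c * + p   ≤⟨ *-monoʳ-≤-nonNeg (+ p) (i<j⇒i≤pred[j] c<1) ⟩
      0ℤ        ∎))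
      where
        open ≤-Reasoning
        c<1 : c < 1ℤ
        c<1 = *-cancelʳ-<-nonNeg (+ p) (begin-strict
          c * + p   ≡⟨ m-v≡cp ⟨
          + m - + v ≤⟨ i-j≤i (+ m) (+ v) ⟩
          + m       <⟨ +<+ m<p ⟩
          + p       ≡⟨ *-identityˡ (+ p) ⟨
          1ℤ * + p  ∎)

    residue-≤ : ∀ x {v} → + p ∣ x - + v → ⟨ x ⟩ p ℕ.≤ v
    residue-≤ x {v} x≡v = p∣m-v∧m<p⇒m≤v
      (∣-resp (∣m∣n⇒∣m-n x≡v (residue-congruence x)) ([i-k]-[i-j]≡j-k x (+ ⟨ x ⟩ p) (+ v)))
      (n%ℕd<d x p)
      where
        [i-k]-[i-j]≡j-k : ∀ i j k → i - k - (i - j) ≡ j - k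
        [i-k]-[i-j]≡j-k = solve-∀

    inverse-residue-basis : ∀ {w B} → ⟨ w * + B ⟩ p ≡ 1 → Basis (- w) (+ p) (+ B) 0ℤ 1ℤ
    inverse-residue-basis {w} {B} ⟨wB⟩≡1 =
      inverse-basis (subst (λ ρ → + p ∣ w * + B - + ρ) ⟨wB⟩≡1 (residue-congruence (w * + B)))

    basis-residue-≤ : ∀ {w A B C D z b} → Basis w (+ A) (+ B) (+ C) (+ D) →
                      A ≡ z ℕ.* B ℕ.+ b → ⟨ w * + b ⟩ p ℕ.≤ z ℕ.* D ℕ.+ C
    basis-residue-≤ {w} {A} {B} {C} {D} {z} {b} basis A≡zB+b = residue-≤ (w * + b)
      (subst (λ c → + p ∣ w * + b - c) (sym (pos-*-+ z D C))
        (basis-truncation {z = + z} {b = + b} basis (trans (cong +_ A≡zB+b) (pos-*-+ z B b))))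

    basis-residue-above : ∀ {w A B C D z n} → Basis w (+ A) (+ B) (+ C) (+ D) →
                          0 ℕ.< D → 0 ℕ.< n → z ℕ.* B ℕ.+ n ℕ.< A →
                          z ℕ.* D ℕ.+ C ℕ.< ⟨ w * + n ⟩ p
    basis-residue-above {w} {A} {B} {C} {D} {z} {n} basis 0<D 0<n zB+n<A =
      let α , β , nD+vB≡αp , αA≡βB+n , v≡αC+βD =
            basis-coordinates {n = + n} {v = + v} basis (residue-congruence (w * + n))
          0<α = *-cancelʳ-<-nonNeg {0ℤ} {α} (+ p) (subst (0ℤ <_) nD+vB≡αp 0<nD+vB)
      in drop‿+<+ (begin-strict
        + (z ℕ.* D ℕ.+ C) ≡⟨ pos-*-+ z D C ⟩
        + z * + D + + C   <⟨ lattice-point-above {A} {B} {C} {D} {+ n} {+ v} {+ z} {α} {β}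
                               0<D 0<α zB+n<A′ αA≡βB+n v≡αC+βD ⟩
        + v               ∎)
      where
        open ≤-Reasoning
        v : ℕ.ℕ
        v = ⟨ w * + n ⟩ p
        zB+n<A′ : + z * + B + + n < + A
        zB+n<A′ = subst (_< + A) (pos-*-+ z B n) (+<+ zB+n<A)
        0<nD+vB : 0ℤ < + n * + D + + v * + B
        0<nD+vB = +-mono-<-≤ (subst (0ℤ <_) (pos-* n D) (+<+ (ℕ.*-mono-≤ 0<n 0<D)))
                             (subst (0ℤ ≤_) (pos-* v B) (+≤+ ℕ.z≤n))

open import Data.Nat using (ℕ; NonZero; _≤_; _<_; _+_; _*_; _∸_; zero; suc; z≤n; s≤s)
open import Data.Integer using (ℤ; +_; ∣_∣) renaming (_*_ to _*ℤ_)
open import Data.Integer.Base using (+<+) renaming (_<_ to _<ℤ_)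
open import Data.Nat.Coprimality using (Coprime)
open import Data.Empty using (⊥-elim)
import Data.Integer.Properties as ℤ
open import Data.Nat.DivMod using (m%n≤m)

m+k*n≡q*n+r⇒n≤m : ∀ {m k n q r} → m + k * n ≡ q * n + r → k < q → n ≤ m
m+k*n≡q*n+r⇒n≤m {m} {k} {n} {q} {r} m+kn≡qn+r k<q = ℕ.+-cancelʳ-≤ (k * n) n m (begin
  suc k * n ≤⟨ ℕ.*-monoˡ-≤ n k<q ⟩
  q * n     ≤⟨ ℕ.m≤m+n (q * n) r ⟩
  q * n + r ≡⟨ m+kn≡qn+r ⟨
  m + k * n ∎)
  where open ℕ.≤-Reasoning

prefix-minimum⇒InDΔ : ∀ u {p b} .{{_ : NonZero p}} →
                      0 < b → PrefixMinimum u p b → InDΔ u p (+ b)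
prefix-minimum⇒InDΔ u {p} {b} 0<b minimal =
  + 0 , + b , (+<+ 0<b , below) , ℤ.+-identityʳ (+ b)
  where
    ⟨u*0⟩≡0 : ⟨ u *ℤ + 0 ⟩ p ≡ 0
    ⟨u*0⟩≡0 = trans (cong (λ x → ⟨ x ⟩ p) (ℤ.*-zeroʳ u)) (ℕ.n≤0⇒n≡0 (m%n≤m 0 p))
    below : ∀ n → + 0 <ℤ n → n <ℤ + b →
            ⟨ u *ℤ + 0 ⟩ p ℕ.⊔ ⟨ u *ℤ + b ⟩ p < ⟨ u *ℤ n ⟩ p
    below (+ n) (+<+ 0<n) (+<+ n<b) =
      subst (λ m → m ℕ.⊔ ⟨ u *ℤ + b ⟩ p < ⟨ u *ℤ + n ⟩ p) (sym ⟨u*0⟩≡0) (minimal n 0<n n<b)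

module EuclideanAlgorithm {p : ℕ} .{{_ : NonZero p}} (u : ℤ) (r Z : ℕ → ℕ) (t : ℕ)
  (r₀≡p : r 0 ≡ p) (r₁<p : r 1 < p) (⟨ur₁⟩≡1 : ⟨ u *ℤ + r 1 ⟩ p ≡ 1)
  (division : ∀ i → 1 ≤ i → i ≤ t → (r (i ∸ 1) ≡ Z i * r i + r (suc i)) × (r (suc i) < r i))
  where

  open CongruenceLattice (+ p)

  division-step : ∀ i → suc i ≤ t → r i ≡ Z (suc i) * r (suc i) + r (suc (suc i))
  division-step i i<t = proj₁ (division (suc i) (s≤s z≤n) i<t)

  r-decreasing : ∀ i → i ≤ t → r (suc i) < r i
  r-decreasing zero    _   = subst (r 1 <_) (sym r₀≡p) r₁<p
  r-decreasing (suc i) i<t = proj₂ (division (suc i) (s≤s z≤n) i<t)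

  quotient-positive : ∀ i → suc i ≤ t → 0 < Z (suc i)
  quotient-positive i i<t with Z (suc i) | division-step i i<t
  ... | suc _ | _         = s≤s z≤n
  ... | zero  | rᵢ≡rᵢ₊₂ = ⊥-elim (ℕ.<-irrefl (sym rᵢ≡rᵢ₊₂)
                            (ℕ.<-trans (r-decreasing (suc i) i<t) (r-decreasing i (ℕ.<⇒≤ i<t))))

  multiplier : ℕ → ℤ
  multiplier zero    = - u
  multiplier (suc i) = - multiplier i

  multiplier-odd : ∀ j → multiplier (suc (2 * j)) ≡ u
  multiplier-odd zero    = ℤ.neg-involutive u
  multiplier-odd (suc j) = begin
    multiplier (suc (2 * suc j)) ≡⟨ cong (λ i → multiplier (suc i)) (ℕ.*-suc 2 j) ⟩
    - - multiplier (suc (2 * j)) ≡⟨ ℤ.neg-involutive _ ⟩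
    multiplier (suc (2 * j))     ≡⟨ multiplier-odd j ⟩
    u                            ∎
    where open ≡-Reasoning

  euclid-basis : ∀ i → i ≤ t →
                 ∃₂ λ C D → Basis (multiplier i) (+ r i) (+ r (suc i)) (+ C) (+ D) × 0 < D
  euclid-basis zero    _   = 0 , 1 , subst (λ A → Basis (- u) (+ A) (+ r 1) (+ 0) (+ 1)) (sym r₀≡p)
                                       (inverse-residue-basis ⟨ur₁⟩≡1) , s≤s z≤n
  euclid-basis (suc i) i<t =
    let C , D , basis , 0<D = euclid-basis i (ℕ.<⇒≤ i<t)
        k = Z (suc i)
    in D , k * D + C ,
       subst (Basis _ _ _ _) (sym (pos-*-+ k D C))
         (basis-step {k = + k} basis
           (trans (cong +_ (division-step i i<t)) (pos-*-+ k _ _))) ,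
       ℕ.≤-trans (ℕ.*-mono-≤ (quotient-positive i i<t) 0<D) (ℕ.m≤m+n (k * D) C)

  prefix-minimum : ∀ i {z b} → suc i ≤ t → z < Z (suc i) → b + z * r (suc i) ≡ r i →
                   0 < b × PrefixMinimum (multiplier i) p b
  prefix-minimum i {z} {b} i<t z<Z b+zB≡A =
    let C , D , basis , 0<D = euclid-basis i (ℕ.<⇒≤ i<t)
    in 0<b , λ n 0<n n<b →
      ℕ.≤-<-trans (basis-residue-≤ {z = z} basis A≡zB+b)
                  (basis-residue-above {z = z} basis 0<D 0<n
                    (subst (z * B + n <_) (sym A≡zB+b) (ℕ.+-monoʳ-< (z * B) n<b)))
    where
      B : ℕ
      B = r (suc i)
      A≡zB+b : r i ≡ z * B + b
      A≡zB+b = trans (sym b+zB≡A) (ℕ.+-comm b (z * B))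
      0<b : 0 < b
      0<b = ℕ.<-≤-trans (ℕ.≤-<-trans z≤n (r-decreasing (suc i) i<t))
                        (m+k*n≡q*n+r⇒n≤m (trans b+zB≡A (division-step i i<t)) z<Z)

  odd-prefix-minimum : ∀ k {z b} → 1 ≤ k → 2 * k ≤ t → z < Z (2 * k) →
                       b + z * r (2 * k) ≡ r (2 * k ∸ 1) → 0 < b × PrefixMinimum u p b
  odd-prefix-minimum (suc j) {z} {b} _ 2k≤t z<Z b+zB≡A =
    subst (λ w → 0 < b × PrefixMinimum w p b) (multiplier-odd j)
      (prefix-minimum (suc (2 * j)) (subst (_≤ t) 2k≡ 2k≤t) (subst (λ m → z < Z m) 2k≡ z<Z)
                                    (subst (λ m → b + z * r m ≡ r (m ∸ 1)) 2k≡ b+zB≡A))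
    where
      2k≡ : 2 * suc j ≡ suc (suc (2 * j))
      2k≡ = ℕ.*-suc 2 j

-- Only ⟨u r₁⟩ = 1 and the division steps up to index 2k are used.
lemma9 : (p : ℕ) .{{_ : NonZero p}} → 3 ≤ p →
         (u : ℤ) → Coprime ∣ u ∣ p →
         (r Z : ℕ → ℕ) (t : ℕ) →
         0 < r 1 → r 1 < p → ⟨ u *ℤ (+ r 1) ⟩ p ≡ 1 →
         r 0 ≡ p →
         (∀ i → 1 ≤ i → i ≤ t → (r (i ∸ 1) ≡ Z i * r i + r (suc i)) × (r (suc i) < r i)) →
         r t ≡ 1 →
         (k : ℕ) → 1 ≤ k → 2 * k ≤ t →
         (z : ℕ) → z < Z (2 * k) →
         (b : ℕ) → b + z * r (2 * k) ≡ r (2 * k ∸ 1) →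
         (∀ (n : ℕ) → 0 < n → n < b → ⟨ u *ℤ (+ b) ⟩ p < ⟨ u *ℤ (+ n) ⟩ p)
         × InDΔ u p (+ b)
lemma9 p _ u _ r Z t _ r₁<p ⟨ur₁⟩≡1 r₀≡p division _ k 1≤k 2k≤t z z<Z b b+zr≡r =
  let 0<b , minimal = odd-prefix-minimum k 1≤k 2k≤t z<Z b+zr≡r
  in minimal , prefix-minimum⇒InDΔ u 0<b minimal
  where open EuclideanAlgorithm u r Z t r₀≡p r₁<p ⟨ur₁⟩≡1 division
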